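{- Let $r\in\{\beta,\beta\eta,h\}$ and $U\in\mathbb U$. If $M:\langle()\vdash U\rangle$ is derivable, then $M\in[U]_r$.
   Context: Indexes: finite sequences of naturals ($\mathcal L_{\mathbb N}$), $\oslash$ empty, $i::L$ prepending, $L::K$ concatenation, $L_1\preceq L_2$ iff $L_2=L_1::L_3$ for some $L_3$. Terms: over a countably infinite set $\mathcal V$ of variables; terms $\mathcal M$, free indexed variables $\mathrm{fv}$, degree $d$, joinability $\diamond$ defined simultaneously: $x^L\in\mathcal M$ ($\mathrm{fv}=\{x^L\}$, $d=L$); $MN\in\mathcal M$ when $d(M)\preceq d(N)$ and $M\diamond N$ ($\mathrm{fv}$ union, $d(MN)=d(M)$); $\lambda x^L.M\in\mathcal M$ when $L\succeq d(M)$ ($\mathrm{fv}=\mathrm{fv}(M)\setminus\{x^L\}$, same degree). $M\diamond N$ iff $x^L\in\mathrm{fv}(M)$, $x^K\in\mathrm{fv}(N)$ imply $L=K$. Terms modulo $\alpha$; substitution $M[x^L:=N]$ defined only if $M\diamond N$, $d(N)=L$. Closed: $\mathrm{fv}(M)=\emptyset$. $\rhd_\beta$: compatible closure of $(\lambda x^L.M)N\rhd M[x^L:=N]$ ($d(N)=L$); $\rhd_\eta$: of $\lambda x^L.(Mx^L)\rhd M$ ($x^L\notin\mathrm{fv}(M)$); $\rhd_{\beta\eta}=\rhd_\beta\cup\rhd_\eta$; $(\lambda x^L.M)NN_1\dots N_n\rhd_h M[x^L:=N]N_1\dots N_n$; $\rhd^*_r$ reflexive–transitive closure. Lifting $(x^L)^{+i}=x^{i::L}$,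 $(M_1M_2)^{+i}=M_1^{+i}M_2^{+i}$, $(\lambda x^L.M)^{+i}=\lambda x^{i::L}.M^{+i}$. Types: atomic types $\mathcal A$, expansion variables $\overline e_0,\overline e_1,\dots$; $\mathbb T\subseteq\mathbb U$ with degree: $a\in\mathbb T$ ($d=\oslash$); $U\to T\in\mathbb T$ for $U\in\mathbb U,T\in\mathbb T$ ($d=\oslash$); $\omega^L\in\mathbb U$ ($d=L$); $U_1\sqcap U_2$ for $d(U_1)=d(U_2)$ (same degree); $\overline e_iU$ ($d=i::d(U)$); modulo $\sqcap$ comm./assoc./idempotent, $\overline e_i(U_1\sqcap U_2)=\overline e_iU_1\sqcap\overline e_iU_2$, $\omega^L\sqcap U=U$ ($d(U)=L$), $\overline e_i\omega^K=\omega^{i::K}$. Environments: finite sets of declarations $x^L:U$ (at most one type per $x^L$); $()$ empty; $env^\omega_M$ assigns $\omega^L$ to each $x^L\in\mathrm{fv}(M)$; $\Gamma_1\sqcap\Gamma_2$ intersects types of common variables and keeps the others; $\overline e_j\Gamma$ replaces each $x^L:U$ by $x^{j::L}:\overline e_jU$; $\Gamma_1\diamond\Gamma_2$ iff $x^L\in\mathrm{dom}\,\Gamma_1$, $x^K\in\mathrm{dom}\,\Gamma_2$ imply $L=K$. Subtyping $\sqsubseteq$: least relation on types, environments, typings closed under reflexivity, transitivity, $U_1\sqcap U_2\sqsubseteq U_1$ ($d(U_1)=d(U_2)$), $U_1\sqcap U_2\sqsubseteq V_1\sqcap V_2$ if $U_i\sqsubseteq V_i$, $U_1\to T_1\sqsubseteq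 U_2\to T_2$ if $U_2\sqsubseteq U_1$, $T_1\sqsubseteq T_2$, $\overline e_iU_1\sqsubseteq\overline e_iU_2$ if $U_1\sqsubseteq U_2$, $\Gamma,y^L:U_1\sqsubseteq\Gamma,y^L:U_2$ if $U_1\sqsubseteq U_2$, $\langle\Gamma_1\vdash U_1\rangle\sqsubseteq\langle\Gamma_2\vdash U_2\rangle$ if $U_1\sqsubseteq U_2$ and $\Gamma_2\sqsubseteq\Gamma_1$. Typing rules ($T\in\mathbb T$): (ax) $x^\oslash:\langle(x^\oslash:T)\vdash T\rangle$; ($\omega$) $M:\langle env^\omega_M\vdash\omega^{d(M)}\rangle$; ($\to_I$) from $M:\langle\Gamma,(x^L:U)\vdash T\rangle$ get $\lambda x^L.M:\langle\Gamma\vdash U\to T\rangle$; ($\to'_I$) from $M:\langle\Gamma\vdash T\rangle$, $x^L\notin\mathrm{dom}\,\Gamma$ get $\lambda x^L.M:\langle\Gamma\vdash\omega^L\to T\rangle$; ($\to_E$) from $M_1:\langle\Gamma_1\vdash U\to T\rangle$, $M_2:\langle\Gamma_2\vdash U\rangle$, $\Gamma_1\diamond\Gamma_2$ get $M_1M_2:\langle\Gamma_1\sqcap\Gamma_2\vdash T\rangle$; ($\sqcap_I$) from $M:\langle\Gamma\vdash U_1\rangle$, $M:\langle\Gamma\vdash U_2\rangle$ get $M:\langle\Gamma\vdash U_1\sqcap U_2\rangle$; ($e$) from $M:\langle\Gamma\vdash U\rangle$ get $M^{+j}:\langle\overline e_j\Gamma\vdash\overline e_jU\rangle$; ($\sqsubseteq$)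 from $M:\langle\Gamma\vdash U\rangle$ and $\langle\Gamma\vdash U\rangle\sqsubseteq\langle\Gamma'\vdash U'\rangle$ get $M:\langle\Gamma'\vdash U'\rangle$. Realisability: $\mathcal V=\mathcal V_1\cup\mathcal V_2$ disjoint, countably infinite. $\mathcal X^{+i}=\{M^{+i}:M\in\mathcal X\}$; $\mathcal X\leadsto\mathcal Y=\{M\in\mathcal M:MN\in\mathcal Y$ for all $N\in\mathcal X$ with $M\diamond N\}$; $\mathcal X$ is $r$-saturated if $M\rhd^*_rN\in\mathcal X$ implies $M\in\mathcal X$. $\mathcal M^L=\{M:d(M)=L\}$; $\mathcal N^L_x=\{x^LN_1\dots N_k\in\mathcal M:k\ge0\}$. An $r$-interpretation is $\mathcal I:\mathcal A\to\mathcal P(\mathcal M^\oslash)$ with each $\mathcal I(a)$ $r$-saturated and $\mathcal N^\oslash_x\subseteq\mathcal I(a)$ for all $x\in\mathcal V_1$, extended by $\mathcal I(\omega^L)=\mathcal M^L$, $\mathcal I(\overline e_iU)=\mathcal I(U)^{+i}$, $\mathcal I(U_1\sqcap U_2)=\mathcal I(U_1)\cap\mathcal I(U_2)$, $\mathcal I(U\to T)=\mathcal I(U)\leadsto\mathcal I(T)$. $[U]_r$ is the set of closed terms belonging to $\mathcal I(U)$ for every $r$-interpretation $\mathcal I$. -}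

module Defs where

open import Data.Nat using (ℕ; zero; suc; _≡ᵇ_)
open import Data.Nat.Properties using () renaming (_≟_ to _≟ℕ_)
open import Data.List using (List; []; _∷_; _++_)
open import Data.List.Properties using (≡-dec)
open import Data.Maybe using (Maybe; just; nothing; map)
open import Data.Bool using (Bool; true; false; if_then_else_; _∧_; _∨_)
open import Data.Product using (Σ; _×_; _,_; ∃)
open import Data.Empty using (⊥)
open import Data.Unit using (⊤)
open import Relation.Nullary using (¬_; does)
open import Relation.Binary.PropositionalEquality using (_≡_; refl; cong)
open import Relation.Binary.Construct.Closure.ReflexiveTransitive using (Star)

Idx : Set
Idx = List ℕ

_⪯_ : Idx → Idx → Set
L₁ ⪯ L₂ = Σ Idx (λ L₃ → L₂ ≡ L₁ ++ L₃)

_≟I_ : (L K : Idx) → Relation.Nullary.Dec (L ≡ K)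
_≟I_ = ≡-dec _≟ℕ_

-- Variables: 𝒱 = 𝒱₁ ∪ 𝒱₂, disjoint and countably infinite

data Var : Set where
  v₁ : ℕ → Var
  v₂ : ℕ → Var

_==V_ : Var → Var → Bool
v₁ m ==V v₁ n = m ≡ᵇ n
v₂ m ==V v₂ n = m ≡ᵇ n
_    ==V _    = false

_==I_ : Idx → Idx → Bool
L ==I K = does (L ≟I K)

-- Raw terms, locally nameless representation (terms modulo α).
-- Free occurrences: fvar x L  (the indexed variable x^L).
-- Bound occurrences: bvar n L  (de Bruijn index n, carrying the index L
-- of its binder, which is checked by well-formedness).

data Tm : Set where
  fvar : Var → Idx → Tm
  bvar : ℕ → Idx → Tm
  app  : Tm → Tm → Tm
  lam  : Idx → Tm → Tm

d : Tm → Idx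
d (fvar _ L) = L
d (bvar _ L) = L
d (app M _)  = d M
d (lam _ M)  = d M

occurs : Var → Idx → Tm → Bool
occurs x L (fvar y K) = (x ==V y) ∧ (L ==I K)
occurs x L (bvar _ _) = false
occurs x L (app M N)  = occurs x L M ∨ occurs x L N
occurs x L (lam _ M)  = occurs x L M

FV : Var → Idx → Tm → Set
FV x L M = occurs x L M ≡ true

Fresh : Var → Tm → Set
Fresh x M = ∀ K → occurs x K M ≡ false

_◇_ : Tm → Tm → Set
M ◇ N = ∀ x L K → FV x L M → FV x K N → L ≡ K

nth : List Idx → ℕ → Maybe Idx
nth []      _       = nothing
nth (L ∷ _) zero    = just L
nth (_ ∷ Δ) (suc n) = nth Δ n

-- well-formedness under a list of binder indexes (innermost first)
data WF (Δ : List Idx) : Tm → Set where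
  wf-fvar : ∀ {x L} → WF Δ (fvar x L)
  wf-bvar : ∀ {n L} → nth Δ n ≡ just L → WF Δ (bvar n L)
  wf-app  : ∀ {M N} → WF Δ M → WF Δ N → d M ⪯ d N → M ◇ N → WF Δ (app M N)
  wf-lam  : ∀ {L M} → WF (L ∷ Δ) M → d M ⪯ L → WF Δ (lam L M)

IsTerm : Tm → Set
IsTerm M = WF [] M

Closed : Tm → Set
Closed M = IsTerm M × (∀ x L → ¬ FV x L M)

openAt : ℕ → Tm → Tm → Tm
openAt k u (fvar x L) = fvar x L
openAt k u (bvar n L) = if n ≡ᵇ k then u else bvar n L
openAt k u (app M N)  = app (openAt k u M) (openAt k u N)
openAt k u (lam L M)  = lam L (openAt (suc k) u M)

lift : ℕ → Tm → Tm
lift i (fvar x L) = fvar x (i ∷ L)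
lift i (bvar n L) = bvar n (i ∷ L)
lift i (app M N)  = app (lift i M) (lift i N)
lift i (lam L M)  = lam (i ∷ L) (lift i M)

data Comp (R : Tm → Tm → Set) : Tm → Tm → Set where
  c-top : ∀ {M N} → R M N → Comp R M N
  c-appl : ∀ {M M' N} → Comp R M M' → Comp R (app M N) (app M' N)
  c-appr : ∀ {M N N'} → Comp R N N' → Comp R (app M N) (app M N')
  c-lam : ∀ {L M M'} (x : Var) → Fresh x M → Fresh x M' →
          Comp R (openAt 0 (fvar x L) M) (openAt 0 (fvar x L) M') →
          Comp R (lam L M) (lam L M')

data BetaTop : Tm → Tm → Set where
  β-top : ∀ {L M N} → d N ≡ L → BetaTop (app (lam L M) N) (openAt 0 N M)

-- λx^L.(M x^L) ▷ M  with x^L ∉ fv(M)  (M locally closed)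
data EtaTop : Tm → Tm → Set where
  η-top : ∀ {L M} → IsTerm M → EtaTop (lam L (app M (bvar 0 L))) M

data BetaEtaTop : Tm → Tm → Set where
  be-β : ∀ {M N} → BetaTop M N → BetaEtaTop M N
  be-η : ∀ {M N} → EtaTop M N → BetaEtaTop M N

data HeadStep : Tm → Tm → Set where
  h-top : ∀ {L M N} → d N ≡ L → HeadStep (app (lam L M) N) (openAt 0 N M)
  h-app : ∀ {M M' N} → HeadStep M M' → HeadStep (app M N) (app M' N)

data Red : Set where
  β βη h : Red

RawStep : Red → Tm → Tm → Set
RawStep β  = Comp BetaTop
RawStep βη = Comp BetaEtaTop
RawStep h  = HeadStep

Step : Red → Tm → Tm → Set
Step r M N = IsTerm M × IsTerm N × RawStep r M N

_▷*_ : ∀ {r : Red} → Tm → Tm → Set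
_▷*_ {r} = Star (Step r)

Atom : Set
Atom = ℕ

mutual
  data TT : Set where
    atom : Atom → TT
    _⇒_  : UU → TT → TT

  data UU : Set where
    ⌜_⌝ : TT → UU
    ω   : Idx → UU
    _⊓_ : UU → UU → UU
    ē   : ℕ → UU → UU

infixr 5 _⇒_
infixl 6 _⊓_

dU : UU → Idx
dU ⌜ _ ⌝    = []
dU (ω L)    = L
dU (U ⊓ _)  = dU U
dU (ē i U)  = i ∷ dU U

mutual
  WFT : TT → Set
  WFT (atom _) = ⊤
  WFT (U ⇒ T)  = WFU U × WFT T

  WFU : UU → Set
  WFU ⌜ T ⌝     = WFT T
  WFU (ω _)     = ⊤
  WFU (U₁ ⊓ U₂) = WFU U₁ × WFU U₂ × dU U₁ ≡ dU U₂
  WFU (ē _ U)   = WFU U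

-- equality of types (the quotient of the paper)
mutual
  data _≈T_ : TT → TT → Set where
    ≈T-refl  : ∀ {T} → T ≈T T
    ≈T-sym   : ∀ {T T'} → T ≈T T' → T' ≈T T
    ≈T-trans : ∀ {T₁ T₂ T₃} → T₁ ≈T T₂ → T₂ ≈T T₃ → T₁ ≈T T₃
    ≈-⇒      : ∀ {U U' T T'} → U ≈U U' → T ≈T T' → (U ⇒ T) ≈T (U' ⇒ T')

  data _≈U_ : UU → UU → Set where
    ≈U-refl  : ∀ {U} → U ≈U U
    ≈U-sym   : ∀ {U U'} → U ≈U U' → U' ≈U U
    ≈U-trans : ∀ {U₁ U₂ U₃} → U₁ ≈U U₂ → U₂ ≈U U₃ → U₁ ≈U U₃
    ≈-⌜⌝     : ∀ {T T'} → T ≈T T' → ⌜ T ⌝ ≈U ⌜ T' ⌝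
    ≈-⊓      : ∀ {U₁ U₂ V₁ V₂} → U₁ ≈U V₁ → U₂ ≈U V₂ → (U₁ ⊓ U₂) ≈U (V₁ ⊓ V₂)
    ≈-ē      : ∀ {i U V} → U ≈U V → ē i U ≈U ē i V
    ⊓-comm   : ∀ {U₁ U₂} → dU U₁ ≡ dU U₂ → (U₁ ⊓ U₂) ≈U (U₂ ⊓ U₁)
    ⊓-assoc  : ∀ {U₁ U₂ U₃} → dU U₁ ≡ dU U₂ → dU U₂ ≡ dU U₃ →
               ((U₁ ⊓ U₂) ⊓ U₃) ≈U (U₁ ⊓ (U₂ ⊓ U₃))
    ⊓-idem   : ∀ {U} → (U ⊓ U) ≈U U
    ē-⊓      : ∀ {i U₁ U₂} → dU U₁ ≡ dU U₂ → ē i (U₁ ⊓ U₂) ≈U (ē i U₁ ⊓ ē i U₂)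
    ω-unit   : ∀ {L U} → dU U ≡ L → (ω L ⊓ U) ≈U U
    ē-ω      : ∀ {i K} → ē i (ω K) ≈U ω (i ∷ K)

data _⊑_ : UU → UU → Set where
  ⊑-≈     : ∀ {U V} → U ≈U V → U ⊑ V
  ⊑-trans : ∀ {U₁ U₂ U₃} → U₁ ⊑ U₂ → U₂ ⊑ U₃ → U₁ ⊑ U₃
  ⊑-⊓     : ∀ {U₁ U₂} → dU U₁ ≡ dU U₂ → (U₁ ⊓ U₂) ⊑ U₁
  ⊑-⊓-mono : ∀ {U₁ U₂ V₁ V₂} → U₁ ⊑ V₁ → U₂ ⊑ V₂ → (U₁ ⊓ U₂) ⊑ (V₁ ⊓ V₂)
  ⊑-⇒     : ∀ {U₁ U₂ T₁ T₂} → U₂ ⊑ U₁ → ⌜ T₁ ⌝ ⊑ ⌜ T₂ ⌝ → ⌜ U₁ ⇒ T₁ ⌝ ⊑ ⌜ U₂ ⇒ T₂ ⌝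
  ⊑-ē     : ∀ {i U₁ U₂} → U₁ ⊑ U₂ → ē i U₁ ⊑ ē i U₂

Env : Set
Env = Var → Idx → Maybe UU

∅E : Env
∅E _ _ = nothing

single : Var → Idx → UU → Env
single x L U y K = if (y ==V x) ∧ (K ==I L) then just U else nothing

extend : Env → Var → Idx → UU → Env
extend Γ x L U y K = if (y ==V x) ∧ (K ==I L) then just U else Γ y K

envω : Tm → Env
envω M x L = if occurs x L M then just (ω L) else nothing

meet : Maybe UU → Maybe UU → Maybe UU
meet (just U) (just V) = just (U ⊓ V)
meet (just U) nothing  = just U
meet nothing  m        = m

_⊓E_ : Env → Env → Env
(Γ₁ ⊓E Γ₂) x L = meet (Γ₁ x L) (Γ₂ x L)

ēE : ℕ → Env → Env
ēE j Γ x []      = nothing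
ēE j Γ x (i ∷ L) = if i ≡ᵇ j then map (ē j) (Γ x L) else nothing

_◇E_ : Env → Env → Set
Γ₁ ◇E Γ₂ = ∀ x L K U V → Γ₁ x L ≡ just U → Γ₂ x K ≡ just V → L ≡ K

WFEnv : Env → Set
WFEnv Γ = ∀ x L U → Γ x L ≡ just U → WFU U

data _⊑M_ : Maybe UU → Maybe UU → Set where
  none : nothing ⊑M nothing
  some : ∀ {U V} → U ⊑ V → just U ⊑M just V

_⊑E_ : Env → Env → Set
Γ ⊑E Γ' = ∀ x L → Γ x L ⊑M Γ' x L

-- Typing  Der M Γ U  ≡  M : ⟨Γ ⊢ U⟩

data Der : Tm → Env → UU → Set where
  ax   : ∀ {x T} → WFT T → Der (fvar x []) (single x [] ⌜ T ⌝) ⌜ T ⌝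
  ω-ty : ∀ {M} → IsTerm M → Der M (envω M) (ω (d M))
  →I   : ∀ {Γ L M U T} (x : Var) → Fresh x M → (∀ K → Γ x K ≡ nothing) →
         IsTerm (lam L M) →
         Der (openAt 0 (fvar x L) M) (extend Γ x L U) ⌜ T ⌝ →
         Der (lam L M) Γ ⌜ U ⇒ T ⌝
  →I'  : ∀ {Γ L M T} (x : Var) → Fresh x M → (∀ K → Γ x K ≡ nothing) →
         IsTerm (lam L M) →
         Der (openAt 0 (fvar x L) M) Γ ⌜ T ⌝ →
         Der (lam L M) Γ ⌜ ω L ⇒ T ⌝
  →E   : ∀ {Γ₁ Γ₂ M₁ M₂ U T} → Der M₁ Γ₁ ⌜ U ⇒ T ⌝ → Der M₂ Γ₂ U →
         Γ₁ ◇E Γ₂ → IsTerm (app M₁ M₂) →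
         Der (app M₁ M₂) (Γ₁ ⊓E Γ₂) ⌜ T ⌝
  ⊓I   : ∀ {M Γ U₁ U₂} → Der M Γ U₁ → Der M Γ U₂ → dU U₁ ≡ dU U₂ →
         Der M Γ (U₁ ⊓ U₂)
  e-ty : ∀ {M Γ U} (j : ℕ) → Der M Γ U → Der (lift j M) (ēE j Γ) (ē j U)
  ⊑-ty : ∀ {M Γ Γ' U U'} → Der M Γ U →
         U ⊑ U' → Γ' ⊑E Γ → WFU U' → WFEnv Γ' →
         Der M Γ' U'

Pred : Set₁
Pred = Tm → Set

Saturated : Red → Pred → Set
Saturated r X = ∀ {M N} → IsTerm M → _▷*_ {r} M N → X N → X M

data Spine (x : Var) (L : Idx) : Tm → Set where
  sp-var : Spine x L (fvar x L)
  sp-app : ∀ {M N} → Spine x L M → Spine x L (app M N)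

Neutral : Var → Idx → Pred
Neutral x L M = Spine x L M × IsTerm M

record Interp (r : Red) : Set₁ where
  field
    I     : Atom → Pred
    I-deg : ∀ a M → I a M → IsTerm M × d M ≡ []
    I-sat : ∀ a → Saturated r (I a)
    I-neu : ∀ a n M → Neutral (v₁ n) [] M → I a M

mutual
  ⟦_⟧T : ∀ {r} → TT → Interp r → Pred
  ⟦ atom a ⟧T 𝓘 M = Interp.I 𝓘 a M
  ⟦ U ⇒ T ⟧T 𝓘 M  = IsTerm M × (∀ N → ⟦ U ⟧U 𝓘 N → M ◇ N → ⟦ T ⟧T 𝓘 (app M N))

  ⟦_⟧U : ∀ {r} → UU → Interp r → Pred
  ⟦ ⌜ T ⌝ ⟧U 𝓘 M   = ⟦ T ⟧T 𝓘 M
  ⟦ ω L ⟧U 𝓘 M     = IsTerm M × d M ≡ L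
  ⟦ U₁ ⊓ U₂ ⟧U 𝓘 M = ⟦ U₁ ⟧U 𝓘 M × ⟦ U₂ ⟧U 𝓘 M
  ⟦ ē i U ⟧U 𝓘 M   = Σ Tm (λ N → ⟦ U ⟧U 𝓘 N × M ≡ lift i N)

Realises : Red → UU → Tm → Set₁
Realises r U M = Closed M × (∀ (𝓘 : Interp r) → ⟦ U ⟧U 𝓘 M)

module Submission where

-- The proof is the classical adequacy argument, carried out for a fixed
-- r-interpretation 𝓘.
--   * ⟦_⟧U does not record that realisers of arrow types have degree ⊘, and
--     without that information it is not closed under subtyping through
--     ill-formed intermediate types.  We therefore use a degree-annotated
--     interpretation SU which does record it.  SU respects type equality and
--     subtyping unconditionally, and agrees with ⟦_⟧U on well-formed types:
--     a ⟦U ⇒ T⟧-realiser applied to a fresh variable of 𝒱₁ (such variables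
--     realise every type) yields a member of ⟦T⟧, hence has degree ⊘.
--   * SU-sets are closed under head expansion, by r-saturation at atoms.
--   * Soundness: if M : ⟨Γ ⊢ U⟩ and σ substitutes for the free variables
--     terms of the right degree, realising the types declared in Γ and
--     keeping the images joinable, then σ(M) ∈ SU U.
-- Corollary 3 is soundness for the identity substitution.

open import Defs
open import Data.Nat using (ℕ; zero; suc; _≡ᵇ_; _⊔_; _≤_; z≤n; s≤s)
open import Data.Nat.Properties using (≡ᵇ⇒≡; ≤-trans; m≤m⊔n; m≤n⊔m; <-irrefl; ≤-refl)
open import Data.List using (List; []; _∷_; _++_; length) renaming (map to mapL)
open import Data.List.Properties using (∷-injectiveʳ)
open import Data.Maybe using (just; nothing; map)
open import Data.Bool using (true; false; if_then_else_; _∧_; _∨_; T)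
open import Data.Product using (Σ; _×_; _,_; proj₁; proj₂)
open import Data.Sum using (_⊎_; inj₁; inj₂)
open import Data.Empty using (⊥; ⊥-elim)
open import Data.Unit using (tt)
open import Relation.Nullary using (¬_; Dec; yes; no; does)
open import Relation.Nullary.Decidable using (dec-true)
open import Relation.Binary.PropositionalEquality
open import Relation.Binary.Construct.Closure.ReflexiveTransitive using (ε; _◅_)
open import Function.Bundles using (_⇔_; mk⇔; module Equivalence)
open import Function.Properties.Equivalence using () renaming (refl to ⇔-refl; sym to ⇔-sym; trans to ⇔-trans)
open import Data.Product.Function.NonDependent.Propositional using (_×-⇔_)
open Equivalence using (to; from)

∨-introˡ : ∀ {a} b → a ≡ true → a ∨ b ≡ true
∨-introˡ b refl = refl

∨-introʳ : ∀ a {b} → b ≡ true → a ∨ b ≡ true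
∨-introʳ true  _ = refl
∨-introʳ false e = e

∨-elim : ∀ a {b} → a ∨ b ≡ true → (a ≡ true) ⊎ (b ≡ true)
∨-elim true  _ = inj₁ refl
∨-elim false e = inj₂ e

∧-elimˡ : ∀ a {b} → a ∧ b ≡ true → a ≡ true
∧-elimˡ true _ = refl

∧-elimʳ : ∀ a {b} → a ∧ b ≡ true → b ≡ true
∧-elimʳ true e = e

true≢false : ∀ {b} → b ≡ true → b ≡ false → ⊥
true≢false refl ()

nothing≢just : ∀ {A : Set} {a : A} → nothing ≡ just a → ⊥
nothing≢just ()

does-sound : ∀ {P : Set} (p? : Dec P) → does p? ≡ true → P
does-sound (yes p) _ = p

≡ᵇ-sound : ∀ m n → (m ≡ᵇ n) ≡ true → m ≡ n
≡ᵇ-sound m n e = ≡ᵇ⇒≡ m n (subst T (sym e) tt)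

≡ᵇ-refl : ∀ n → (n ≡ᵇ n) ≡ true
≡ᵇ-refl zero    = refl
≡ᵇ-refl (suc n) = ≡ᵇ-refl n

≡ᵇ-<-false : ∀ n m → suc m ≤ n → (n ≡ᵇ m) ≡ false
≡ᵇ-<-false n m m<n with n ≡ᵇ m in eq
... | false = refl
... | true with ≡ᵇ-sound n m eq
...   | refl = ⊥-elim (<-irrefl refl m<n)

==I-sound : ∀ L K → L ==I K ≡ true → L ≡ K
==I-sound L K = does-sound (L ≟I K)

==I-refl : ∀ L → L ==I L ≡ true
==I-refl L = dec-true (L ≟I L) refl

==V-sound : ∀ x y → x ==V y ≡ true → x ≡ y
==V-sound (v₁ m) (v₁ n) e = cong v₁ (≡ᵇ-sound m n e)
==V-sound (v₂ m) (v₂ n) e = cong v₂ (≡ᵇ-sound m n e)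

==V-refl : ∀ x → x ==V x ≡ true
==V-refl (v₁ n) = ≡ᵇ-refl n
==V-refl (v₂ n) = ≡ᵇ-refl n

FV-fvar : ∀ {x L y K} → FV x L (fvar y K) → x ≡ y × L ≡ K
FV-fvar {x} {L} {y} {K} e =
  ==V-sound x y (∧-elimˡ (x ==V y) e) , ==I-sound L K (∧-elimʳ (x ==V y) e)

FV-self : ∀ x L → FV x L (fvar x L)
FV-self x L rewrite ==V-refl x | ==I-refl L = refl

FV-appˡ : ∀ {x L} M N → FV x L M → FV x L (app M N)
FV-appˡ {x} {L} M N = ∨-introˡ (occurs x L N)

FV-appʳ : ∀ {x L} M N → FV x L N → FV x L (app M N)
FV-appʳ {x} {L} M N = ∨-introʳ (occurs x L M)

FV-app : ∀ {x L} M N → FV x L (app M N) → FV x L M ⊎ FV x L N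
FV-app {x} {L} M N = ∨-elim (occurs x L M)

FV-open-keep : ∀ {x L} k u M → FV x L M → FV x L (openAt k u M)
FV-open-keep k u (fvar y K) e = e
FV-open-keep k u (app M N) e with FV-app M N e
... | inj₁ e = FV-appˡ (openAt k u M) (openAt k u N) (FV-open-keep k u M e)
... | inj₂ e = FV-appʳ (openAt k u M) (openAt k u N) (FV-open-keep k u N e)
FV-open-keep k u (lam K M) e = FV-open-keep (suc k) u M e

FV-open : ∀ {x L} k u M → FV x L (openAt k u M) → FV x L u ⊎ FV x L M
FV-open k u (fvar y K) e = inj₂ e
FV-open k u (bvar n K) e with n ≡ᵇ k
... | true  = inj₁ e
... | false = inj₂ e
FV-open k u (app M N) e with FV-app (openAt k u M) (openAt k u N) e
... | inj₁ e with FV-open k u M e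
...   | inj₁ a = inj₁ a
...   | inj₂ b = inj₂ (FV-appˡ M N b)
FV-open k u (app M N) e | inj₂ e′ with FV-open k u N e′
...   | inj₁ a = inj₁ a
...   | inj₂ b = inj₂ (FV-appʳ M N b)
FV-open k u (lam K M) e = FV-open (suc k) u M e

FV-lift : ∀ {x L} j M → FV x L M → FV x (j ∷ L) (lift j M)
FV-lift {x} {L} j (fvar y K) e with FV-fvar {x} {L} {y} {K} e
... | refl , refl = FV-self x (j ∷ L)
FV-lift j (app M N) e with FV-app M N e
... | inj₁ e = FV-appˡ (lift j M) (lift j N) (FV-lift j M e)
... | inj₂ e = FV-appʳ (lift j M) (lift j N) (FV-lift j N e)
FV-lift j (lam K M) e = FV-lift j M e

FV-unlift : ∀ {x L′} j M → FV x L′ (lift j M) → Σ Idx λ L → L′ ≡ j ∷ L × FV x L M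
FV-unlift {x} {L′} j (fvar y K) e with FV-fvar {x} {L′} {y} {j ∷ K} e
... | refl , refl = K , refl , FV-self y K
FV-unlift j (app M N) e with FV-app (lift j M) (lift j N) e
... | inj₁ e with FV-unlift j M e
...   | L , eq , f = L , eq , FV-appˡ M N f
FV-unlift j (app M N) e | inj₂ e′ with FV-unlift j N e′
...   | L , eq , f = L , eq , FV-appʳ M N f
FV-unlift j (lam K M) e = FV-unlift j M e

Fresh-distinct : ∀ x M y K → Fresh x M → FV y K M → (y ==V x) ≡ false
Fresh-distinct x M y K fr f with y ==V x in eq
... | false = refl
... | true with ==V-sound y x eq
...   | refl = ⊥-elim (true≢false f (fr K))

maxV₁ : Tm → ℕ
maxV₁ (fvar (v₁ m) _) = suc m
maxV₁ (fvar (v₂ m) _) = 0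
maxV₁ (bvar _ _)      = 0
maxV₁ (app M N)       = maxV₁ M ⊔ maxV₁ N
maxV₁ (lam _ M)       = maxV₁ M

maxV₁-fresh : ∀ M n K → maxV₁ M ≤ n → occurs (v₁ n) K M ≡ false
maxV₁-fresh (fvar (v₁ m) L) n K le rewrite ≡ᵇ-<-false n m le = refl
maxV₁-fresh (fvar (v₂ m) L) n K le = refl
maxV₁-fresh (bvar _ _)      n K le = refl
maxV₁-fresh (app M N)       n K le
  rewrite maxV₁-fresh M n K (≤-trans (m≤m⊔n (maxV₁ M) (maxV₁ N)) le)
        | maxV₁-fresh N n K (≤-trans (m≤n⊔m (maxV₁ M) (maxV₁ N)) le) = refl
maxV₁-fresh (lam _ M)       n K le = maxV₁-fresh M n K le

-- every term is joinable with itself: free variables have a unique index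
◇-refl : ∀ {Δ N} → WF Δ N → N ◇ N
◇-refl (wf-fvar {y} {K}) x L L′ e e′ =
  trans (proj₂ (FV-fvar {x} {L} {y} {K} e)) (sym (proj₂ (FV-fvar {x} {L′} {y} {K} e′)))
◇-refl (wf-app {M} {N} wM wN _ M◇N) x L L′ e e′ with FV-app M N e | FV-app M N e′
... | inj₁ a | inj₁ b = ◇-refl wM x L L′ a b
... | inj₁ a | inj₂ b = M◇N x L L′ a b
... | inj₂ a | inj₁ b = sym (M◇N x L′ L b a)
... | inj₂ a | inj₂ b = ◇-refl wN x L L′ a b
◇-refl (wf-lam wM _) = ◇-refl wM

nth-++ : ∀ Δ Δ′ n {L} → nth Δ n ≡ just L → nth (Δ ++ Δ′) n ≡ just L
nth-++ (_ ∷ Δ) Δ′ zero    e = e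
nth-++ (_ ∷ Δ) Δ′ (suc n) e = nth-++ Δ Δ′ n e

WF-weaken : ∀ {Δ} Δ′ {M} → WF Δ M → WF (Δ ++ Δ′) M
WF-weaken Δ′ wf-fvar               = wf-fvar
WF-weaken {Δ} Δ′ (wf-bvar {n} e)   = wf-bvar (nth-++ Δ Δ′ n e)
WF-weaken Δ′ (wf-app wM wN M⪯N M◇N) = wf-app (WF-weaken Δ′ wM) (WF-weaken Δ′ wN) M⪯N M◇N
WF-weaken Δ′ (wf-lam wM M⪯L)        = wf-lam (WF-weaken Δ′ wM) M⪯L

nth-length : ∀ Δ n {L} → nth Δ n ≡ just L → suc n ≤ length Δ
nth-length (_ ∷ Δ) zero    e = s≤s z≤n
nth-length (_ ∷ Δ) (suc n) e = s≤s (nth-length Δ n e)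

open-closed : ∀ {Δ} k u M → WF Δ M → length Δ ≤ k → openAt k u M ≡ M
open-closed k u (fvar x L) w le = refl
open-closed {Δ} k u (bvar n L) (wf-bvar e) le with n ≡ᵇ k in eq
... | false = refl
... | true with ≡ᵇ-sound n k eq
...   | refl = ⊥-elim (<-irrefl refl (≤-trans (nth-length Δ n e) le))
open-closed k u (app M N) (wf-app wM wN _ _) le =
  cong₂ app (open-closed k u M wM le) (open-closed k u N wN le)
open-closed k u (lam L M) (wf-lam wM _) le = cong (lam L) (open-closed (suc k) u M wM (s≤s le))

d-open : ∀ {Δ} k u {L} M → WF Δ M → nth Δ k ≡ just L → d u ≡ L → d (openAt k u M) ≡ d M
d-open k u (fvar x L) w e du = refl
d-open k u (bvar n L′) (wf-bvar e′) e du with n ≡ᵇ k in eq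
... | false = refl
... | true with ≡ᵇ-sound n k eq
...   | refl with trans (sym e) e′
...     | refl = du
d-open k u (app M N) (wf-app wM _ _ _) e du = d-open k u M wM e du
d-open k u (lam L′ M) (wf-lam wM _) e du = d-open (suc k) u M wM e du

⪯-from-[] : ∀ {A B} → A ≡ [] → A ⪯ B
⪯-from-[] {B = B} refl = B , refl

d-lift : ∀ j M → d (lift j M) ≡ j ∷ d M
d-lift j (fvar x L) = refl
d-lift j (bvar n L) = refl
d-lift j (app M N)  = d-lift j M
d-lift j (lam L M)  = d-lift j M

lift-◇ : ∀ j M N → M ◇ N → lift j M ◇ lift j N
lift-◇ j M N M◇N x A B e e′ with FV-unlift j M e | FV-unlift j N e′
... | A′ , refl , f | B′ , refl , f′ = cong (j ∷_) (M◇N x A′ B′ f f′)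

unlift-◇ : ∀ j M N → lift j M ◇ lift j N → M ◇ N
unlift-◇ j M N j◇ x A B e e′ = ∷-injectiveʳ (j◇ x (j ∷ A) (j ∷ B) (FV-lift j M e) (FV-lift j N e′))

nth-map : ∀ (f : Idx → Idx) Δ n → nth (mapL f Δ) n ≡ map f (nth Δ n)
nth-map f []      n       = refl
nth-map f (_ ∷ Δ) zero    = refl
nth-map f (_ ∷ Δ) (suc n) = nth-map f Δ n

lift-WF : ∀ j {Δ M} → WF Δ M → WF (mapL (j ∷_) Δ) (lift j M)
lift-WF j wf-fvar = wf-fvar
lift-WF j {Δ} (wf-bvar {n} e) = wf-bvar (trans (nth-map (j ∷_) Δ n) (cong (map (j ∷_)) e))
lift-WF j (wf-app {M} {N} wM wN (L₃ , eq) M◇N) =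
  wf-app (lift-WF j wM) (lift-WF j wN)
    (L₃ , trans (d-lift j N) (trans (cong (j ∷_) eq) (cong (_++ L₃) (sym (d-lift j M)))))
    (lift-◇ j M N M◇N)
lift-WF j (wf-lam {L} {M} wM (L₃ , eq)) =
  wf-lam (lift-WF j wM) (L₃ , trans (cong (j ∷_) eq) (cong (_++ L₃) (sym (d-lift j M))))

lift-injective : ∀ j M N → lift j M ≡ lift j N → M ≡ N
lift-injective j (fvar x L) (fvar .x .L) refl = refl
lift-injective j (bvar n L) (bvar .n .L) refl = refl
lift-injective j (app M M′) (app N N′) e with lift j M in eM | lift j M′ in eM′
lift-injective j (app M M′) (app N N′) refl | _ | _ =
  cong₂ app (lift-injective j M N eM) (lift-injective j M′ N′ eM′)
lift-injective j (lam L M) (lam K N) e with lift j M in eM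
lift-injective j (lam L M) (lam .L N) refl | _ = cong (lam L) (lift-injective j M N eM)

nth-map-inv : ∀ j Δ n {L} → nth (mapL (j ∷_) Δ) n ≡ just L →
              Σ Idx λ L′ → nth Δ n ≡ just L′ × L ≡ j ∷ L′
nth-map-inv j (L ∷ Δ) zero    refl = L , refl , refl
nth-map-inv j (_ ∷ Δ) (suc n) e    = nth-map-inv j Δ n e

unlift : ∀ i Δ M → WF (mapL (i ∷_) Δ) M → Σ Idx (λ A → d M ≡ i ∷ A) →
         Σ Tm λ N → WF Δ N × M ≡ lift i N
unlift i Δ (fvar x .(i ∷ A)) wf-fvar (A , refl) = fvar x A , wf-fvar , refl
unlift i Δ (bvar n L) (wf-bvar e) _ with nth-map-inv i Δ n e
... | L′ , e′ , refl = bvar n L′ , wf-bvar e′ , refl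
unlift i Δ (app M N) (wf-app wM wN (L₃ , dN) M◇N) (A , dM)
  with unlift i Δ M wM (A , dM) | unlift i Δ N wN (A ++ L₃ , trans dN (cong (_++ L₃) dM))
... | M′ , wM′ , refl | N′ , wN′ , refl =
  app M′ N′ ,
  wf-app wM′ wN′ (L₃ , ∷-injectiveʳ (trans (sym (d-lift i N′)) (trans dN (cong (_++ L₃) (d-lift i M′)))))
         (unlift-◇ i M′ N′ M◇N) ,
  refl
unlift i Δ (lam L M) (wf-lam wM (L₃ , refl)) (A , dM) = unlift-lam (d M) dM wM
  where
  unlift-lam : ∀ D → D ≡ i ∷ A → WF ((D ++ L₃) ∷ mapL (i ∷_) Δ) M →
               Σ Tm λ N → WF Δ N × lam (D ++ L₃) M ≡ lift i N
  unlift-lam .(i ∷ A) refl w with unlift i ((A ++ L₃) ∷ Δ) M w (A , dM)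
  ... | M′ , wM′ , refl =
    lam (A ++ L₃) M′ ,
    wf-lam wM′ (L₃ , cong (_++ L₃) (sym (∷-injectiveʳ (trans (sym (d-lift i M′)) dM)))) ,
    refl

Sub : Set
Sub = Var → Idx → Tm

sub : Sub → Tm → Tm
sub σ (fvar x L) = σ x L
sub σ (bvar n L) = bvar n L
sub σ (app M N)  = app (sub σ M) (sub σ N)
sub σ (lam L M)  = lam L (sub σ M)

Good : Sub → Set
Good σ = ∀ x L → IsTerm (σ x L) × d (σ x L) ≡ L

Coh : Sub → Tm → Set
Coh σ M = ∀ x L x′ L′ y K K′ → FV x L M → FV x′ L′ M →
          FV y K (σ x L) → FV y K′ (σ x′ L′) → K ≡ K′

ι : Sub
ι = fvar

sub-ι : ∀ M → sub ι M ≡ M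
sub-ι (fvar x L) = refl
sub-ι (bvar n L) = refl
sub-ι (app M N)  = cong₂ app (sub-ι M) (sub-ι N)
sub-ι (lam L M)  = cong (lam L) (sub-ι M)

Coh-ι : ∀ M → IsTerm M → Coh ι M
Coh-ι M wM a A a′ A′ y K K′ f f′ g g′
  with FV-fvar {y} {K} {a} {A} g | FV-fvar {y} {K′} {a′} {A′} g′
... | refl , refl | refl , refl = ◇-refl wM y K K′ f f′

d-sub : ∀ σ → Good σ → ∀ M → d (sub σ M) ≡ d M
d-sub σ g (fvar x L) = proj₂ (g x L)
d-sub σ g (bvar n L) = refl
d-sub σ g (app M N)  = d-sub σ g M
d-sub σ g (lam L M)  = d-sub σ g M

FV-sub : ∀ σ M {y K} → FV y K (sub σ M) → Σ Var λ x → Σ Idx λ L → FV x L M × FV y K (σ x L)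
FV-sub σ (fvar x L) e = x , L , FV-self x L , e
FV-sub σ (app M N) e with FV-app (sub σ M) (sub σ N) e
... | inj₁ e with FV-sub σ M e
...   | x , L , f , g = x , L , FV-appˡ M N f , g
FV-sub σ (app M N) e | inj₂ e′ with FV-sub σ N e′
...   | x , L , f , g = x , L , FV-appʳ M N f , g
FV-sub σ (lam L M) e = FV-sub σ M e

FV-sub-keep : ∀ σ M {x L y K} → FV x L M → FV y K (σ x L) → FV y K (sub σ M)
FV-sub-keep σ (fvar x′ L′) {x} {L} f g with FV-fvar {x} {L} {x′} {L′} f
... | refl , refl = g
FV-sub-keep σ (app M N) f g with FV-app M N f
... | inj₁ f = FV-appˡ (sub σ M) (sub σ N) (FV-sub-keep σ M f g)
... | inj₂ f = FV-appʳ (sub σ M) (sub σ N) (FV-sub-keep σ N f g)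
FV-sub-keep σ (lam L M) f g = FV-sub-keep σ M f g

Coh-appˡ : ∀ σ M N → Coh σ (app M N) → Coh σ M
Coh-appˡ σ M N c x L x′ L′ y K K′ f f′ = c x L x′ L′ y K K′ (FV-appˡ M N f) (FV-appˡ M N f′)

Coh-appʳ : ∀ σ M N → Coh σ (app M N) → Coh σ N
Coh-appʳ σ M N c x L x′ L′ y K K′ f f′ = c x L x′ L′ y K K′ (FV-appʳ M N f) (FV-appʳ M N f′)

sub-◇ : ∀ σ M N → Coh σ (app M N) → sub σ M ◇ sub σ N
sub-◇ σ M N c y K K′ e e′ with FV-sub σ M e | FV-sub σ N e′
... | x , L , f , g | x′ , L′ , f′ , g′ = c x L x′ L′ y K K′ (FV-appˡ M N f) (FV-appʳ M N f′) g g′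

WF-sub : ∀ σ → Good σ → ∀ {Δ M} → WF Δ M → Coh σ M → WF Δ (sub σ M)
WF-sub σ g {Δ} (wf-fvar {x} {L}) c = WF-weaken Δ (proj₁ (g x L))
WF-sub σ g (wf-bvar e) c = wf-bvar e
WF-sub σ g (wf-app {M} {N} wM wN (L₃ , eq) _) c =
  wf-app (WF-sub σ g wM (Coh-appˡ σ M N c)) (WF-sub σ g wN (Coh-appʳ σ M N c))
    (L₃ , trans (d-sub σ g N) (trans eq (cong (_++ L₃) (sym (d-sub σ g M))))) (sub-◇ σ M N c)
WF-sub σ g (wf-lam {L} {M} wM (L₃ , eq)) c =
  wf-lam (WF-sub σ g wM c) (L₃ , trans eq (cong (_++ L₃) (sym (d-sub σ g M))))

sub-cong : ∀ σ τ M → (∀ x L → FV x L M → σ x L ≡ τ x L) → sub σ M ≡ sub τ M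
sub-cong σ τ (fvar x L) agree = agree x L (FV-self x L)
sub-cong σ τ (bvar n L) agree = refl
sub-cong σ τ (app M N)  agree = cong₂ app (sub-cong σ τ M (λ x L f → agree x L (FV-appˡ M N f)))
                                          (sub-cong σ τ N (λ x L f → agree x L (FV-appʳ M N f)))
sub-cong σ τ (lam L M)  agree = cong (lam L) (sub-cong σ τ M agree)

sub-open : ∀ σ → Good σ → ∀ k u M → sub σ (openAt k u M) ≡ openAt k (sub σ u) (sub σ M)
sub-open σ g k u (fvar x L) = sym (open-closed k (sub σ u) (σ x L) (proj₁ (g x L)) z≤n)
sub-open σ g k u (bvar n L) with n ≡ᵇ k
... | true  = refl
... | false = refl
sub-open σ g k u (app M N) = cong₂ app (sub-open σ g k u M) (sub-open σ g k u N)
sub-open σ g k u (lam L M) = cong (lam L) (sub-open σ g (suc k) u M)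

sub-lift : ∀ j σ τ → (∀ x L → σ x (j ∷ L) ≡ lift j (τ x L)) → ∀ M → sub σ (lift j M) ≡ lift j (sub τ M)
sub-lift j σ τ agree (fvar x L) = agree x L
sub-lift j σ τ agree (bvar n L) = refl
sub-lift j σ τ agree (app M N)  = cong₂ app (sub-lift j σ τ agree M) (sub-lift j σ τ agree N)
sub-lift j σ τ agree (lam L M)  = cong (lam (j ∷ L)) (sub-lift j σ τ agree M)

unlift-sub : ∀ j σ → Good σ →
             Σ Sub λ τ → Good τ × (∀ x L → σ x (j ∷ L) ≡ lift j (τ x L))
unlift-sub j σ g = τ , good , λ x L → proj₂ (proj₂ (image x L))
  where
  image : ∀ x L → Σ Tm λ N → IsTerm N × σ x (j ∷ L) ≡ lift j N
  image x L = unlift j [] (σ x (j ∷ L)) (proj₁ (g x (j ∷ L))) (L , proj₂ (g x (j ∷ L)))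
  τ : Sub
  τ x L = proj₁ (image x L)
  good : Good τ
  good x L with image x L
  ... | N , wN , eq = wN , ∷-injectiveʳ (trans (sym (d-lift j N)) (trans (cong d (sym eq)) (proj₂ (g x (j ∷ L)))))

Coh-unlift : ∀ j σ τ → (∀ x L → σ x (j ∷ L) ≡ lift j (τ x L)) → ∀ M → Coh σ (lift j M) → Coh τ M
Coh-unlift j σ τ στ M c a A a′ A′ y K K′ f f′ g g′ =
  ∷-injectiveʳ (c a (j ∷ A) a′ (j ∷ A′) y (j ∷ K) (j ∷ K′) (FV-lift j M f) (FV-lift j M f′)
    (subst (FV y (j ∷ K)) (sym (στ a A)) (FV-lift j (τ a A) g))
    (subst (FV y (j ∷ K′)) (sym (στ a′ A′)) (FV-lift j (τ a′ A′) g′)))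

update : Sub → Var → Idx → Tm → Sub
update σ x L N y K = if (y ==V x) ∧ (K ==I L) then N else σ y K

update-same : ∀ σ x L N → update σ x L N x L ≡ N
update-same σ x L N rewrite ==V-refl x | ==I-refl L = refl

update-other : ∀ σ x L N y K → (y ==V x) ≡ false → update σ x L N y K ≡ σ y K
update-other σ x L N y K e rewrite e = refl

update-Good : ∀ σ x L N → Good σ → IsTerm N → d N ≡ L → Good (update σ x L N)
update-Good σ x L N g wN dN y K with (y ==V x) ∧ (K ==I L) in eq
... | true  = wN , trans dN (sym (==I-sound K L (∧-elimʳ (y ==V x) eq)))
... | false = g y K

FV-open-fresh : ∀ x L M a A → Fresh x M → FV a A (openAt 0 (fvar x L) M) →
                (a ≡ x × A ≡ L) ⊎ (FV a A M × (a ==V x) ≡ false)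
FV-open-fresh x L M a A fr f with FV-open 0 (fvar x L) M f
... | inj₁ e = inj₁ (FV-fvar {a} {A} {x} {L} e)
... | inj₂ e = inj₂ (e , Fresh-distinct x M a A fr e)

update-Coh : ∀ σ x L N M → Fresh x M → Coh σ M → IsTerm N →
             (∀ y K a A → FV a A M → FV y K (σ a A) → ∀ K′ → FV y K′ N → K ≡ K′) →
             Coh (update σ x L N) (openAt 0 (fvar x L) M)
update-Coh σ x L N M fr c wN N◇σM a A a′ A′ y K K′ f f′ g g′
  with FV-open-fresh x L M a A fr f | FV-open-fresh x L M a′ A′ fr f′
... | inj₁ (refl , refl) | inj₁ (refl , refl) =
  ◇-refl wN y K K′ (subst (FV y K) (update-same σ x L N) g) (subst (FV y K′) (update-same σ x L N) g′)
... | inj₁ (refl , refl) | inj₂ (fM′ , ne′) =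
  sym (N◇σM y K′ a′ A′ fM′ (subst (FV y K′) (update-other σ x L N a′ A′ ne′) g′) K
            (subst (FV y K) (update-same σ x L N) g))
... | inj₂ (fM , ne) | inj₁ (refl , refl) =
  N◇σM y K a A fM (subst (FV y K) (update-other σ x L N a A ne) g) K′
       (subst (FV y K′) (update-same σ x L N) g′)
... | inj₂ (fM , ne) | inj₂ (fM′ , ne′) =
  c a A a′ A′ y K K′ fM fM′ (subst (FV y K) (update-other σ x L N a A ne) g)
                          (subst (FV y K′) (update-other σ x L N a′ A′ ne′) g′)

sub-open-update : ∀ σ x L N M → Good (update σ x L N) → Fresh x M →
                  sub (update σ x L N) (openAt 0 (fvar x L) M) ≡ openAt 0 N (sub σ M)
sub-open-update σ x L N M g fr = begin
  sub σ′ (openAt 0 (fvar x L) M)    ≡⟨ sub-open σ′ g 0 (fvar x L) M ⟩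
  openAt 0 (σ′ x L) (sub σ′ M)      ≡⟨ cong₂ (openAt 0) (update-same σ x L N) (sub-cong σ′ σ M unchanged) ⟩
  openAt 0 N (sub σ M)              ∎
  where
  open ≡-Reasoning
  σ′ = update σ x L N
  unchanged : ∀ y K → FV y K M → σ′ y K ≡ σ y K
  unchanged y K f = update-other σ x L N y K (Fresh-distinct x M y K fr f)

-- apps M [Pₙ, …, P₁] = M P₁ … Pₙ
apps : Tm → List Tm → Tm
apps M []       = M
apps M (P ∷ Ps) = app (apps M Ps) P

d-apps : ∀ M Ps → d (apps M Ps) ≡ d M
d-apps M []       = refl
d-apps M (P ∷ Ps) = d-apps M Ps

WF-apps-head : ∀ M Ps → IsTerm (apps M Ps) → IsTerm M
WF-apps-head M []       w = w
WF-apps-head M (P ∷ Ps) (wf-app w _ _ _) = WF-apps-head M Ps w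

FV-apps-mono : ∀ M M′ Ps → (∀ y K → FV y K M → FV y K M′) →
               ∀ y K → FV y K (apps M Ps) → FV y K (apps M′ Ps)
FV-apps-mono M M′ []       m y K e = m y K e
FV-apps-mono M M′ (P ∷ Ps) m y K e with FV-app (apps M Ps) P e
... | inj₁ e = FV-appˡ (apps M′ Ps) P (FV-apps-mono M M′ Ps m y K e)
... | inj₂ e = FV-appʳ (apps M′ Ps) P e

head-step : ∀ r L B N Ps → d N ≡ L → RawStep r (apps (app (lam L B) N) Ps) (apps (openAt 0 N B) Ps)
head-step β  L B N []       dN = c-top (β-top dN)
head-step βη L B N []       dN = c-top (be-β (β-top dN))
head-step h  L B N []       dN = h-top dN
head-step β  L B N (P ∷ Ps) dN = c-appl (head-step β L B N Ps dN)
head-step βη L B N (P ∷ Ps) dN = c-appl (head-step βη L B N Ps dN)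
head-step h  L B N (P ∷ Ps) dN = h-app (head-step h L B N Ps dN)

spine-deg : ∀ {x L M} → Spine x L M → d M ≡ L
spine-deg sp-var     = refl
spine-deg (sp-app s) = spine-deg s

d-contract : ∀ L B N Ps → IsTerm (apps (app (lam L B) N) Ps) → d N ≡ L →
             d (apps (openAt 0 N B) Ps) ≡ d (apps (app (lam L B) N) Ps)
d-contract L B N Ps w dN with WF-apps-head (app (lam L B) N) Ps w
... | wf-app (wf-lam wB _) _ _ _ = begin
  d (apps (openAt 0 N B) Ps)       ≡⟨ d-apps (openAt 0 N B) Ps ⟩
  d (openAt 0 N B)                 ≡⟨ d-open 0 N B wB refl dN ⟩
  d B                              ≡⟨ sym (d-apps (app (lam L B) N) Ps) ⟩
  d (apps (app (lam L B) N) Ps)    ∎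
  where open ≡-Reasoning

FV-contract : ∀ L B N Ps y K → FV y K (apps (openAt 0 N B) Ps) → FV y K (apps (app (lam L B) N) Ps)
FV-contract L B N Ps = FV-apps-mono (openAt 0 N B) (app (lam L B) N) Ps redex-FV
  where
  redex-FV : ∀ y K → FV y K (openAt 0 N B) → FV y K (app (lam L B) N)
  redex-FV y K e with FV-open 0 N B e
  ... | inj₁ e = FV-appʳ (lam L B) N e
  ... | inj₂ e = FV-appˡ (lam L B) N e

dU-≈ : ∀ {U V} → U ≈U V → dU U ≡ dU V
dU-≈ ≈U-refl          = refl
dU-≈ (≈U-sym e)       = sym (dU-≈ e)
dU-≈ (≈U-trans e e′)  = trans (dU-≈ e) (dU-≈ e′)
dU-≈ (≈-⌜⌝ _)         = refl
dU-≈ (≈-⊓ e _)        = dU-≈ e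
dU-≈ (≈-ē {i} e)      = cong (i ∷_) (dU-≈ e)
dU-≈ (⊓-comm eq)      = eq
dU-≈ (⊓-assoc _ _)    = refl
dU-≈ ⊓-idem           = refl
dU-≈ (ē-⊓ _)          = refl
dU-≈ (ω-unit eq)      = sym eq
dU-≈ ē-ω              = refl

dU-⊑ : ∀ {U V} → U ⊑ V → dU U ≡ dU V
dU-⊑ (⊑-≈ e)          = dU-≈ e
dU-⊑ (⊑-trans s s′)   = trans (dU-⊑ s) (dU-⊑ s′)
dU-⊑ (⊑-⊓ _)          = refl
dU-⊑ (⊑-⊓-mono s _)   = dU-⊑ s
dU-⊑ (⊑-⇒ _ _)        = refl
dU-⊑ (⊑-ē {i} s)      = cong (i ∷_) (dU-⊑ s)

single-same : ∀ x L U → single x L U x L ≡ just U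
single-same x L U rewrite ==V-refl x | ==I-refl L = refl

extend-same : ∀ Γ x L U → extend Γ x L U x L ≡ just U
extend-same Γ x L U rewrite ==V-refl x | ==I-refl L = refl

extend-other : ∀ Γ x L U y K → (y ==V x) ≡ false → extend Γ x L U y K ≡ Γ y K
extend-other Γ x L U y K e rewrite e = refl

ēE-declared : ∀ j Γ x L V → Γ x L ≡ just V → ēE j Γ x (j ∷ L) ≡ just (ē j V)
ēE-declared j Γ x L V e rewrite ≡ᵇ-refl j | e = refl

if-just : ∀ {A : Set} b (a : A) {v} → (if b then just a else nothing) ≡ just v → b ≡ true × a ≡ v
if-just true a refl = refl , refl

if-just-map : ∀ j b m {v} → (if b then map (ē j) m else nothing) ≡ just v →
              b ≡ true × Σ UU λ W → m ≡ just W × v ≡ ē j W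
if-just-map j true (just W) refl = refl , W , refl , refl

-- W is V or a binary meet having V as a component: what a declaration of
-- Γ₁ (or Γ₂) becomes in Γ₁ ⊓E Γ₂
data Conjunct (V : UU) : UU → Set where
  itself : Conjunct V V
  leftOf  : ∀ {V′} → Conjunct V (V ⊓ V′)
  rightOf : ∀ {V′} → Conjunct V (V′ ⊓ V)

meet-justˡ : ∀ a b {V} → a ≡ just V → Σ UU λ W → meet a b ≡ just W × Conjunct V W
meet-justˡ (just U) (just W) refl = U ⊓ W , refl , leftOf
meet-justˡ (just U) nothing  refl = U , refl , itself

meet-justʳ : ∀ a b {V} → b ≡ just V → Σ UU λ W → meet a b ≡ just W × Conjunct V W
meet-justʳ (just U) (just W) refl = U ⊓ W , refl , rightOf
meet-justʳ nothing  (just W) refl = W , refl , itself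

meet-deg : ∀ {K} a b V → (∀ U → a ≡ just U → dU U ≡ K) → (∀ U → b ≡ just U → dU U ≡ K) →
           meet a b ≡ just V → dU V ≡ K
meet-deg (just U) (just W) V da db refl = da U refl
meet-deg (just U) nothing  V da db refl = da U refl
meet-deg nothing  b        V da db e    = db V e

⊑M-above : ∀ {a b V} → a ≡ just V → a ⊑M b → Σ UU λ W → b ≡ just W × V ⊑ W
⊑M-above refl (some s) = _ , refl , s

⊑M-below : ∀ {a b V} → b ≡ just V → a ⊑M b → Σ UU λ W → a ≡ just W × W ⊑ V
⊑M-below refl (some s) = _ , refl , s

Der-term : ∀ {M Γ U} → Der M Γ U → IsTerm M
Der-term (ax _)              = wf-fvar
Der-term (ω-ty w)            = w
Der-term (→I _ _ _ w _)      = w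
Der-term (→I' _ _ _ w _)     = w
Der-term (→E _ _ _ w)        = w
Der-term (⊓I D _ _)          = Der-term D
Der-term (e-ty j D)          = lift-WF j (Der-term D)
Der-term (⊑-ty D _ _ _ _)    = Der-term D

Der-deg : ∀ {M Γ U} → Der M Γ U → d M ≡ dU U
Der-deg (ax _)   = refl
Der-deg (ω-ty _) = refl
Der-deg (→I {L = L} {M = M} x _ _ (wf-lam w _) D) =
  trans (sym (d-open 0 (fvar x L) M w refl refl)) (Der-deg D)
Der-deg (→I' {L = L} {M = M} x _ _ (wf-lam w _) D) =
  trans (sym (d-open 0 (fvar x L) M w refl refl)) (Der-deg D)
Der-deg (→E D _ _ _)       = Der-deg D
Der-deg (⊓I D _ _)         = Der-deg D
Der-deg (e-ty {M} j D)     = trans (d-lift j M) (cong (j ∷_) (Der-deg D))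
Der-deg (⊑-ty D s _ _ _)   = trans (Der-deg D) (dU-⊑ s)

Der-env-deg : ∀ {M Γ U} → Der M Γ U → ∀ x L V → Γ x L ≡ just V → dU V ≡ L
Der-env-deg (ax {x} {T} _) y K V e with if-just ((y ==V x) ∧ (K ==I [])) ⌜ T ⌝ e
... | b , refl = sym (==I-sound K [] (∧-elimʳ (y ==V x) b))
Der-env-deg (ω-ty {M} _) y K V e with if-just (occurs y K M) (ω K) e
... | _ , refl = refl
Der-env-deg (→I {Γ} {L} {M} {U} x _ Γx _ D) y K V e with y ==V x in eq
... | false = Der-env-deg D y K V (trans (extend-other Γ x L U y K eq) e)
... | true with ==V-sound y x eq
...   | refl = ⊥-elim (nothing≢just (trans (sym (Γx K)) e))
Der-env-deg (→I' _ _ _ _ D) = Der-env-deg D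
Der-env-deg (→E {Γ₁} {Γ₂} D₁ D₂ _ _) y K V =
  meet-deg (Γ₁ y K) (Γ₂ y K) V (Der-env-deg D₁ y K) (Der-env-deg D₂ y K)
Der-env-deg (⊓I D _ _) = Der-env-deg D
Der-env-deg (e-ty {Γ = Γ} j D) y (i ∷ K) V e with if-just-map j (i ≡ᵇ j) (Γ y K) e
... | b , W , eW , refl with ≡ᵇ-sound i j b
...   | refl = cong (i ∷_) (Der-env-deg D y K W eW)
Der-env-deg (⊑-ty D _ Γ′⊑Γ _ _) y K V e with ⊑M-above e (Γ′⊑Γ y K)
... | W , eW , s = trans (dU-⊑ s) (Der-env-deg D y K W eW)

Der-env-dom : ∀ {M Γ U} → Der M Γ U → ∀ x L → FV x L M → Σ UU λ V → Γ x L ≡ just V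
Der-env-dom (ax {x} {T} _) y K f with FV-fvar {y} {K} {x} {[]} f
... | refl , refl = ⌜ T ⌝ , single-same x [] ⌜ T ⌝
Der-env-dom (ω-ty {M} _) y K f rewrite f = ω K , refl
Der-env-dom (→I {Γ} {L} {M} {U} x fr _ _ D) y K f
  with Der-env-dom D y K (FV-open-keep 0 (fvar x L) M f)
... | V , e = V , trans (sym (extend-other Γ x L U y K (Fresh-distinct x M y K fr f))) e
Der-env-dom (→I' {L = L} {M = M} x _ _ _ D) y K f = Der-env-dom D y K (FV-open-keep 0 (fvar x L) M f)
Der-env-dom (→E {Γ₁} {Γ₂} {M₁} {M₂} D₁ D₂ _ _) y K f with FV-app M₁ M₂ f
... | inj₁ f = let W , e , _ = meet-justˡ (Γ₁ y K) (Γ₂ y K) (proj₂ (Der-env-dom D₁ y K f)) in W , e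
... | inj₂ f = let W , e , _ = meet-justʳ (Γ₁ y K) (Γ₂ y K) (proj₂ (Der-env-dom D₂ y K f)) in W , e
Der-env-dom (⊓I D _ _) = Der-env-dom D
Der-env-dom (e-ty {M} {Γ} j D) y K′ f with FV-unlift j M f
... | K , refl , f′ = let V , e = Der-env-dom D y K f′ in ē j V , ēE-declared j Γ y K V e
Der-env-dom (⊑-ty D _ Γ′⊑Γ _ _) y K f with Der-env-dom D y K f
... | V , e = let W , eW , _ = ⊑M-below e (Γ′⊑Γ y K) in W , eW


module Semantics {r : Red} (𝓘 : Interp r) where
  open Interp 𝓘

  -- like ⟦_⟧, but realisers of arrow types are required to have degree ⊘
  mutual
    ST : TT → Tm → Set
    ST (atom a) M = I a M
    ST (U ⇒ T)  M = IsTerm M × d M ≡ [] × (∀ N → SU U N → M ◇ N → ST T (app M N))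

    SU : UU → Tm → Set
    SU ⌜ T ⌝   M = ST T M
    SU (ω L)   M = IsTerm M × d M ≡ L
    SU (U ⊓ V) M = SU U M × SU V M
    SU (ē i U) M = Σ Tm λ N → SU U N × M ≡ lift i N

  ST-term : ∀ T M → ST T M → IsTerm M × d M ≡ []
  ST-term (atom a) M s            = I-deg a M s
  ST-term (U ⇒ T)  M (w , dM , _) = w , dM

  SU-term : ∀ U M → SU U M → IsTerm M × d M ≡ dU U
  SU-term ⌜ T ⌝   M s       = ST-term T M s
  SU-term (ω L)   M s       = s
  SU-term (U ⊓ V) M (s , _) = SU-term U M s
  SU-term (ē i U) .(lift i N) (N , s , refl) =
    lift-WF i (proj₁ (SU-term U N s)) , trans (d-lift i N) (cong (i ∷_) (proj₂ (SU-term U N s)))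

  SU-ēω : ∀ i K M → IsTerm M → d M ≡ i ∷ K → SU (ē i (ω K)) M
  SU-ēω i K M w dM with unlift i [] M w (K , dM)
  ... | N , wN , refl = N , (wN , ∷-injectiveʳ (trans (sym (d-lift i N)) dM)) , refl

  mutual
    ≈T-sound : ∀ {T T′} → T ≈T T′ → ∀ M → ST T M ⇔ ST T′ M
    ≈T-sound ≈T-refl         M = ⇔-refl
    ≈T-sound (≈T-sym e)      M = ⇔-sym (≈T-sound e M)
    ≈T-sound (≈T-trans e e′) M = ⇔-trans (≈T-sound e M) (≈T-sound e′ M)
    ≈T-sound (≈-⇒ eU eT)     M = mk⇔
      (λ (w , dM , f) → w , dM , λ N s j → to (≈T-sound eT (app M N)) (f N (from (≈U-sound eU N) s) j))
      (λ (w , dM , f) → w , dM , λ N s j → from (≈T-sound eT (app M N)) (f N (to (≈U-sound eU N) s) j))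

    ≈U-sound : ∀ {U U′} → U ≈U U′ → ∀ M → SU U M ⇔ SU U′ M
    ≈U-sound ≈U-refl         M = ⇔-refl
    ≈U-sound (≈U-sym e)      M = ⇔-sym (≈U-sound e M)
    ≈U-sound (≈U-trans e e′) M = ⇔-trans (≈U-sound e M) (≈U-sound e′ M)
    ≈U-sound (≈-⌜⌝ e)        M = ≈T-sound e M
    ≈U-sound (≈-⊓ e e′)      M = ≈U-sound e M ×-⇔ ≈U-sound e′ M
    ≈U-sound (≈-ē e)         M = mk⇔
      (λ (N , s , eq) → N , to (≈U-sound e N) s , eq)
      (λ (N , s , eq) → N , from (≈U-sound e N) s , eq)
    ≈U-sound (⊓-comm _)      M = mk⇔ (λ (s , s′) → s′ , s) (λ (s , s′) → s′ , s)
    ≈U-sound (⊓-assoc _ _)   M = mk⇔ (λ ((s , s′) , s″) → s , (s′ , s″)) (λ (s , (s′ , s″)) → (s , s′) , s″)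
    ≈U-sound ⊓-idem          M = mk⇔ proj₁ (λ s → s , s)
    ≈U-sound (ē-⊓ {i} {U₁} {U₂} _) M = mk⇔
      (λ (N , (s , s′) , eq) → (N , s , eq) , (N , s′ , eq))
      (λ ((N , s , eq) , (N′ , s′ , eq′)) →
         N , (s , subst (SU U₂) (lift-injective i N′ N (trans (sym eq′) eq)) s′) , eq)
    ≈U-sound (ω-unit {L} {U} dU≡L) M = mk⇔ proj₂
      (λ s → (proj₁ (SU-term U M s) , trans (proj₂ (SU-term U M s)) dU≡L) , s)
    ≈U-sound (ē-ω {i} {K})  M = mk⇔
      (λ (N , (w , dN) , eq) → subst (λ M → IsTerm M × d M ≡ i ∷ K) (sym eq)
                                 (lift-WF i w , trans (d-lift i N) (cong (i ∷_) dN)))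
      (λ (w , dM) → SU-ēω i K M w dM)

  ⊑-sound : ∀ {U V} → U ⊑ V → ∀ M → SU U M → SU V M
  ⊑-sound (⊑-≈ e)          M           = to (≈U-sound e M)
  ⊑-sound (⊑-trans s s′)   M r         = ⊑-sound s′ M (⊑-sound s M r)
  ⊑-sound (⊑-⊓ _)          M           = proj₁
  ⊑-sound (⊑-⊓-mono s s′)  M (r , r′)  = ⊑-sound s M r , ⊑-sound s′ M r′
  ⊑-sound (⊑-⇒ s s′)       M (w , dM , f) =
    w , dM , λ N rN j → ⊑-sound s′ (app M N) (f N (⊑-sound s N rN) j)
  ⊑-sound (⊑-ē s)          M (N , rN , eq) = N , ⊑-sound s N rN , eq

  Conjunct-sound : ∀ {V W} → Conjunct V W → ∀ M → SU W M → SU V M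
  Conjunct-sound itself  M s = s
  Conjunct-sound leftOf  M s = proj₁ s
  Conjunct-sound rightOf M s = proj₂ s

  neutral-ST : ∀ T n M → Spine (v₁ n) [] M → IsTerm M → ST T M
  neutral-ST (atom a) n M sp w = I-neu a n M (sp , w)
  neutral-ST (U ⇒ T)  n M sp w = w , spine-deg sp , λ N s j →
    neutral-ST T n (app M N) (sp-app sp) (wf-app w (proj₁ (SU-term U N s)) (⪯-from-[] (spine-deg sp)) j)

  variable-SU : ∀ U n → WFU U → SU U (fvar (v₁ n) (dU U))
  variable-SU ⌜ T ⌝   n w = neutral-ST T n _ sp-var wf-fvar
  variable-SU (ω L)   n w = wf-fvar , refl
  variable-SU (U ⊓ V) n (w , w′ , dU≡dV) =
    variable-SU U n w , subst (λ L → SU V (fvar (v₁ n) L)) (sym dU≡dV) (variable-SU V n w′)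
  variable-SU (ē i U) n w = fvar (v₁ n) (dU U) , variable-SU U n w , refl

  fresh-◇ : ∀ M K → M ◇ fvar (v₁ (maxV₁ M)) K
  fresh-◇ M K x L L′ e e′ with FV-fvar {x} {L′} {v₁ (maxV₁ M)} {K} e′
  ... | refl , _ = ⊥-elim (true≢false e (maxV₁-fresh M (maxV₁ M) L ≤-refl))

  -- on well-formed types the annotated interpretation is ⟦_⟧: a realiser
  -- of U ⇒ T has degree ⊘ because applied to a fresh variable it realises T
  mutual
    ST-agrees : ∀ T → WFT T → ∀ M → ⟦ T ⟧T 𝓘 M ⇔ ST T M
    ST-agrees (atom a) _ M = ⇔-refl
    ST-agrees (U ⇒ T) (wU , wT) M = mk⇔
      (λ (w , f) → w , degree f , λ N s j → to (ST-agrees T wT (app M N)) (f N (from (SU-agrees U wU N) s) j))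
      (λ (w , _ , f) → w , λ N s j → from (ST-agrees T wT (app M N)) (f N (to (SU-agrees U wU N) s) j))
      where
      x₀ : Tm
      x₀ = fvar (v₁ (maxV₁ M)) (dU U)
      degree : (∀ N → ⟦ U ⟧U 𝓘 N → M ◇ N → ⟦ T ⟧T 𝓘 (app M N)) → d M ≡ []
      degree f = proj₂ (ST-term T (app M x₀) (to (ST-agrees T wT (app M x₀))
                   (f x₀ (from (SU-agrees U wU x₀) (variable-SU U (maxV₁ M) wU)) (fresh-◇ M (dU U)))))

    SU-agrees : ∀ U → WFU U → ∀ M → ⟦ U ⟧U 𝓘 M ⇔ SU U M
    SU-agrees ⌜ T ⌝   w          M = ST-agrees T w M
    SU-agrees (ω L)   _          M = ⇔-refl
    SU-agrees (U ⊓ V) (w , w′ , _) M = SU-agrees U w M ×-⇔ SU-agrees V w′ M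
    SU-agrees (ē i U) w          M = mk⇔
      (λ (N , s , eq) → N , to (SU-agrees U w N) s , eq)
      (λ (N , s , eq) → N , from (SU-agrees U w N) s , eq)

  -- realisers are closed under head β-expansion (atoms are r-saturated)
  ST-expand : ∀ T L B N Ps → IsTerm (apps (app (lam L B) N) Ps) → d N ≡ L →
              ST T (apps (openAt 0 N B) Ps) → ST T (apps (app (lam L B) N) Ps)
  ST-expand (atom a) L B N Ps w dN s =
    I-sat a w ((w , proj₁ (I-deg a _ s) , head-step r L B N Ps dN) ◅ ε) s
  ST-expand (U ⇒ T)  L B N Ps w dN (_ , dC , f) = w , dR , λ P s j →
    ST-expand T L B N (P ∷ Ps) (wf-app w (proj₁ (SU-term U P s)) (⪯-from-[] dR) j) dN
      (f P s (λ y K K′ e → j y K K′ (FV-contract L B N Ps y K e)))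
    where
    dR : d (apps (app (lam L B) N) Ps) ≡ []
    dR = trans (sym (d-contract L B N Ps w dN)) dC

  Valid : Env → Sub → Set
  Valid Γ σ = ∀ x L V → Γ x L ≡ just V → SU V (σ x L)

  Valid-extend : ∀ Γ x L U σ N → (∀ K → Γ x K ≡ nothing) → Valid Γ σ → SU U N →
                 Valid (extend Γ x L U) (update σ x L N)
  Valid-extend Γ x L U σ N Γx va s y K V e with y ==V x in eq
  ... | false = va y K V e
  ... | true with ==V-sound y x eq
  ...   | refl with K ≟I L
  ...     | yes refl with e
  ...       | refl = s
  Valid-extend Γ x L U σ N Γx va s y K V e | true | refl | no _ =
    ⊥-elim (nothing≢just (trans (sym (Γx K)) e))

  Valid-update : ∀ Γ x L σ N → (∀ K → Γ x K ≡ nothing) → Valid Γ σ → Valid Γ (update σ x L N)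
  Valid-update Γ x L σ N Γx va y K V e with y ==V x in eq
  ... | false = va y K V e
  ... | true with ==V-sound y x eq
  ...   | refl = ⊥-elim (nothing≢just (trans (sym (Γx K)) e))

  Valid-meetˡ : ∀ Γ₁ Γ₂ σ → Valid (Γ₁ ⊓E Γ₂) σ → Valid Γ₁ σ
  Valid-meetˡ Γ₁ Γ₂ σ va y K V e =
    let W , eW , V∈W = meet-justˡ (Γ₁ y K) (Γ₂ y K) e in Conjunct-sound V∈W (σ y K) (va y K W eW)

  Valid-meetʳ : ∀ Γ₁ Γ₂ σ → Valid (Γ₁ ⊓E Γ₂) σ → Valid Γ₂ σ
  Valid-meetʳ Γ₁ Γ₂ σ va y K V e =
    let W , eW , V∈W = meet-justʳ (Γ₁ y K) (Γ₂ y K) e in Conjunct-sound V∈W (σ y K) (va y K W eW)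

  Valid-⊑ : ∀ Γ Γ′ σ → Γ′ ⊑E Γ → Valid Γ′ σ → Valid Γ σ
  Valid-⊑ Γ Γ′ σ Γ′⊑Γ va y K V e =
    let W , eW , W⊑V = ⊑M-below e (Γ′⊑Γ y K) in ⊑-sound W⊑V (σ y K) (va y K W eW)

  Valid-unlift : ∀ j Γ σ τ → (∀ x L → σ x (j ∷ L) ≡ lift j (τ x L)) →
                 Valid (ēE j Γ) σ → Valid Γ τ
  Valid-unlift j Γ σ τ στ va y K V e =
    let N , s , eq = va y (j ∷ K) (ē j V) (ēE-declared j Γ y K V e)
    in subst (SU V) (lift-injective j N (τ y K) (trans (sym eq) (στ y K))) s

  SU-abstraction : ∀ {L M U T} x σ → Fresh x M → Good σ → Coh σ M → IsTerm (lam L M) → d M ≡ [] →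
    (∀ N → SU U N → d N ≡ L) →
    (∀ N → SU U N → Good (update σ x L N) → Coh (update σ x L N) (openAt 0 (fvar x L) M) →
       ST T (sub (update σ x L N) (openAt 0 (fvar x L) M))) →
    ST (U ⇒ T) (lam L (sub σ M))
  SU-abstraction {L} {M} {U} {T} x σ fr g c wλ dM arg-deg body = wλσ , dλσ , apply
    where
    wλσ : IsTerm (lam L (sub σ M))
    wλσ = WF-sub σ g wλ c
    dλσ : d (sub σ M) ≡ []
    dλσ = trans (d-sub σ g M) dM
    apply : ∀ N → SU U N → lam L (sub σ M) ◇ N → ST T (app (lam L (sub σ M)) N)
    apply N s j = ST-expand T L (sub σ M) N [] (wf-app wλσ wN (⪯-from-[] dλσ) j) dN
                    (subst (ST T) (sub-open-update σ x L N M g′ fr) (body N s g′ c′))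
      where
      wN = proj₁ (SU-term U N s)
      dN = arg-deg N s
      g′ = update-Good σ x L N g wN dN
      c′ = update-Coh σ x L N M fr c wN (λ y K a A f f′ K′ f″ → j y K K′ (FV-sub-keep σ M f f′) f″)

  sound : ∀ {M Γ U} → Der M Γ U → ∀ σ → Good σ → Valid Γ σ → Coh σ M → SU U (sub σ M)
  sound (ax {x} {T} _) σ g va c = va x [] ⌜ T ⌝ (single-same x [] ⌜ T ⌝)
  sound (ω-ty {M} w)   σ g va c = WF-sub σ g w c , d-sub σ g M
  sound D@(→I {Γ} {L} {M} {U} {T} x fr Γx wλ D′) σ g va c =
    SU-abstraction {U = U} {T = T} x σ fr g c wλ (Der-deg D) arg-deg
      (λ N s g′ c′ → sound D′ (update σ x L N) g′ (Valid-extend Γ x L U σ N Γx va s) c′)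
    where
    arg-deg : ∀ N → SU U N → d N ≡ L
    arg-deg N s = trans (proj₂ (SU-term U N s)) (Der-env-deg D′ x L U (extend-same Γ x L U))
  sound D@(→I' {Γ} {L} {T = T} x fr Γx wλ D′) σ g va c =
    SU-abstraction {U = ω L} {T = T} x σ fr g c wλ (Der-deg D) (λ N → proj₂)
      (λ N s g′ c′ → sound D′ (update σ x L N) g′ (Valid-update Γ x L σ N Γx va) c′)
  sound (→E {Γ₁} {Γ₂} {M₁} {M₂} D₁ D₂ _ _) σ g va c =
    proj₂ (proj₂ (sound D₁ σ g (Valid-meetˡ Γ₁ Γ₂ σ va) (Coh-appˡ σ M₁ M₂ c)))
      (sub σ M₂) (sound D₂ σ g (Valid-meetʳ Γ₁ Γ₂ σ va) (Coh-appʳ σ M₁ M₂ c)) (sub-◇ σ M₁ M₂ c)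
  sound (⊓I D₁ D₂ _) σ g va c = sound D₁ σ g va c , sound D₂ σ g va c
  sound (e-ty {M} {Γ} j D) σ g va c with unlift-sub j σ g
  ... | τ , gτ , στ =
    sub τ M , sound D τ gτ (Valid-unlift j Γ σ τ στ va) (Coh-unlift j σ τ στ M c) , sub-lift j σ τ στ M
  sound (⊑-ty {M} {Γ} {Γ′} D U⊑U′ Γ′⊑Γ _ _) σ g va c =
    ⊑-sound U⊑U′ (sub σ M) (sound D σ g (Valid-⊑ Γ Γ′ σ Γ′⊑Γ va) c)

corollary3 : (r : Red) (U : UU) (M : Tm) → WFU U → Der M ∅E U → Realises r U M
corollary3 r U M wU D = (Der-term D , closed) , realises
  where
  closed : ∀ x L → ¬ FV x L M
  closed x L f with Der-env-dom D x L f
  ... | _ , ()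
  realises : (𝓘 : Interp r) → ⟦ U ⟧U 𝓘 M
  realises 𝓘 = from (SU-agrees U wU M) (subst (SU U) (sub-ι M) identity-sound)
    where
    open Semantics 𝓘
    identity-sound : SU U (sub ι M)
    identity-sound = sound D ι (λ x L → wf-fvar , refl) (λ _ _ _ ()) (Coh-ι M (Der-term D))
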